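{- Let $G$ be a graph and let $S \subseteq V(G)$ be a Carathéodory independent set in the cycle convexity of $G$ with $|S|\geq 2$. Then: (a) $G[S]$ contains at least one edge; (b) every vertex of $S$ lies on some cycle of $G$; (c) $\langle S\rangle$ induces a connected subgraph of $G$; (d) no proper subset $S'\subsetneq S$ satisfies $\langle S'\rangle = V(G)$; (e) $G[S]$ is a forest; (f) $G[\langle S\rangle]$ has no vertex of degree $1$ (no leaves); (g) $S$ is not cycle convex.
   Context: All graphs are finite, simple and undirected; $G[X]$ denotes the subgraph induced by $X$. A set $S\subseteq V(G)$ is cycle convex if for every $u\in V(G)\setminus S$ the graph $G[S\cup\{u\}]$ contains no cycle passing through $u$. The cycle convex hull $\langle S\rangle$ of $S$ is the smallest cycle convex set containing $S$ (so $\langle\emptyset\rangle=\emptyset$). A set $S$ is Carathéodory independent (C-independent) if there is a vertex $p\in\langle S\rangle$ with $p\notin \bigcup_{a\in S}\langle S\setminus\{a\}\rangle$. -}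

module Defs where

open import Data.Nat using (ℕ; _≤_)
open import Data.Bool using (Bool; true; false)
open import Data.Fin using (Fin)
open import Data.Fin.Subset using (Subset; _∈_; _∉_; _⊆_; _⊂_; _∪_; _-_; ⁅_⁆; ∣_∣)
open import Data.List using (List; _∷_; []; _++_; length)
open import Data.List.Relation.Unary.All using (All)
open import Data.List.Relation.Unary.Unique.Propositional using (Unique)
open import Data.List.Relation.Unary.Linked using (Linked)
open import Data.List.Membership.Propositional using () renaming (_∈_ to _∈ₗ_)
open import Data.Product using (Σ; ∃; _×_; _,_)
open import Relation.Binary.PropositionalEquality using (_≡_)
open import Relation.Nullary using (¬_)

record Graph (n : ℕ) : Set where
  field
    adj   : Fin n → Fin n → Bool
    sym   : ∀ x y → adj x y ≡ adj y x
    irrefl : ∀ x → adj x x ≡ false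

module _ {n : ℕ} (G : Graph n) where
  open Graph G

  Edge : Fin n → Fin n → Set
  Edge x y = adj x y ≡ true

  -- A cycle of G: distinct vertices v₀, v₁, …, v_k (k ≥ 2, i.e. at least
  -- three vertices) with v_i ~ v_{i+1} and v_k ~ v₀.
  record Cycle : Set where
    constructor mkCycle
    field
      start    : Fin n
      rest     : List (Fin n)
      long     : 2 ≤ length rest
      distinct : Unique (start ∷ rest)
      closed   : Linked Edge (start ∷ rest ++ (start ∷ []))

  vertices : Cycle → List (Fin n)
  vertices c = Cycle.start c ∷ Cycle.rest c

  -- A cycle of the induced subgraph G[X]: a cycle of G all of whose
  -- vertices lie in X.
  CycleIn : Subset n → Cycle → Set
  CycleIn X c = All (_∈ X) (vertices c)

  HasCycleThrough : Subset n → Fin n → Set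
  HasCycleThrough X u = Σ Cycle λ c → CycleIn X c × u ∈ₗ vertices c

  CycleConvex : Subset n → Set
  CycleConvex S = ∀ u → u ∉ S → ¬ HasCycleThrough (S ∪ ⁅ u ⁆) u

  -- Membership in the cycle convex hull ⟨S⟩: the smallest cycle convex set
  -- containing S, i.e. the intersection of all cycle convex supersets of S.
  _∈⟨_⟩ : Fin n → Subset n → Set
  x ∈⟨ S ⟩ = ∀ T → CycleConvex T → S ⊆ T → x ∈ T

  CIndependent : Subset n → Set
  CIndependent S = ∃ λ p → p ∈⟨ S ⟩ × (∀ a → a ∈ S → ¬ (p ∈⟨ S - a ⟩))

  data WalkIn (P : Fin n → Set) : Fin n → Fin n → Set where
    here : ∀ {x} → WalkIn P x x
    step : ∀ {x y z} → Edge x y → P y → WalkIn P y z → WalkIn P x z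

  ConnectedIn : (Fin n → Set) → Set
  ConnectedIn P = ∀ x y → P x → P y → WalkIn P x y

  DegreeOneIn : (Fin n → Set) → Fin n → Set
  DegreeOneIn P v = ∃ λ w → P w × Edge v w × (∀ z → P z → Edge v z → z ≡ w)

  Forest : Subset n → Set
  Forest S = ∀ c → ¬ CycleIn S c

-- Let p witness the independence of S: p ∈ ⟨S⟩ but p ∉ ⟨S − a⟩ for every a ∈ S. As |S| ≥ 2 we get
-- p ∉ S (otherwise p ∈ S − b for some b ≠ p), so S is not convex (g); edgeless sets are convex, hence (a).
-- A cycle of G[S] through a puts a into ⟨S − a⟩ and then p too (e), and (d) is immediate.
-- For a ∈ S no convex set lies between S and ⟨S − a⟩ ∪ {a}, as it would contain p. A vertex lying on no
-- cycle of a convex set Y can be deleted from Y, or added to a convex subset of Y, keeping convexity; for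
-- Y = ⟨S⟩ this shows that every vertex of ⟨S⟩ lies on a cycle of G[⟨S⟩], which gives (b) and (f).
-- For (c) let K be the component of p in G[⟨S⟩]. Then (⟨S ∩ K⟩ ∩ K) ∪ (⟨S⟩ ∖ K) is convex and contains S,
-- so p ∈ ⟨S ∩ K⟩, which forces S ⊆ K; and K is convex, so ⟨S⟩ ⊆ K.
-- The witnesses (edge, cycle, walk) are found by finite search: cycle existence, hull membership and
-- reachability are all decidable.

module Submission where

open import Defs
open import Level using (0ℓ)
open import Data.Nat using (ℕ; zero; suc; _≤_; z≤n; s≤s; _≤?_)
open import Data.Nat.Properties using (≤-trans; <-irrefl; suc-injective)
open import Data.Bool using (true)
import Data.Bool.Properties as Bool
open import Data.Fin using (Fin; zero; suc; _≟_)
open import Data.Fin.Properties using (any?; all?; injective⇒≤)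
open import Data.Fin.Subset using (Subset; inside; _∈_; _∉_; _⊆_; _⊂_; _∪_; _∩_; _─_; _-_; ⁅_⁆; ∣_∣)
open import Data.Fin.Subset.Properties
  using ( _∈?_; _⊆?_; anySubset?; x∈p∪q⁺; x∈p∪q⁻; x∈p∩q⁺; x∈p∩q⁻; x∈⁅x⁆; x∈⁅y⁆⇒x≡y
        ; x∈p∧x∉q⇒x∈p─q; x∈p∧x≢y⇒x∈p-y; p─q⊆p; p⊆q⇒∣p∣≤∣q∣; p⊂q⇒∣p∣<∣q∣; ∣p∣≤n; ∣⁅x⁆∣≡1 )
open import Data.Vec using (_∷_; here; there; tabulate)
open import Data.Vec.Properties using (lookup∘tabulate; lookup⇒[]=; []=⇒lookup)
open import Data.List using (List; []; _∷_; _++_; length; lookup)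
open import Data.List.Properties using (++-assoc)
open import Data.List.Relation.Unary.All as All using (All; []; _∷_)
import Data.List.Relation.Unary.All.Properties as Allₚ
open import Data.List.Relation.Unary.AllPairs using (_∷_)
open import Data.List.Relation.Unary.Any using (here; there)
open import Data.List.Relation.Unary.Linked using (Linked; [-]; _∷_; linked?)
open import Data.List.Relation.Unary.Unique.Propositional using (Unique)
import Data.List.Relation.Unary.Unique.DecPropositional as UniqueDec
open import Data.List.Membership.Propositional using () renaming (_∈_ to _∈ₗ_)
open import Data.List.Membership.Propositional.Properties using (∈-∃++; ∈-lookup)
import Data.List.Membership.DecPropositional as MembershipDec
open import Data.List.Relation.Binary.Permutation.Propositional using (_↭_; ↭-refl; ↭-sym; ↭⇒↭ₛ)
open import Data.List.Relation.Binary.Permutation.Propositional.Properties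
  using (++-comm; ↭-length; ∈-resp-↭; All-resp-↭)
import Data.List.Relation.Binary.Permutation.Setoid.Properties as Permutationₛ
open import Data.Product using (Σ; ∃; ∃₂; _×_; _,_; proj₁; proj₂; map₁; map₂)
open import Data.Sum using (_⊎_; inj₁; inj₂; [_,_]′)
import Data.Sum as Sum
open import Data.Empty using (⊥; ⊥-elim)
open import Function using (_∘_; id)
open import Relation.Binary.PropositionalEquality using (_≡_; _≢_; refl; sym; trans; cong; subst; setoid)
open import Relation.Nullary using (¬_; Dec; yes; no; does; contradiction)
open import Relation.Nullary.Decidable
  using (_×-dec_; _⊎-dec_; _→-dec_; ¬?; map′; decidable-stable; dec-true)
open import Relation.Unary using (Pred; Decidable)

x∈p─q⇒x∉q : ∀ {n} {x : Fin n} (p q : Subset n) → x ∈ p ─ q → x ∉ q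
x∈p─q⇒x∉q (_ ∷ p) (inside ∷ q) () here
x∈p─q⇒x∉q (_ ∷ p) (_ ∷ q) (there x∈p─q) (there x∈q) = x∈p─q⇒x∉q p q x∈p─q x∈q

another-element : ∀ {n} {X : Subset n} → 2 ≤ ∣ X ∣ → ∀ x → ∃ λ y → y ∈ X × y ≢ x
another-element {X = X} 2≤∣X∣ x =
  decidable-stable (any? λ y → y ∈? X ×-dec ¬? (y ≟ x)) λ none →
    contradiction (≤-trans 2≤∣X∣ (subst (∣ X ∣ ≤_) (∣⁅x⁆∣≡1 x) (p⊆q⇒∣p∣≤∣q∣ (X⊆⁅x⁆ none))))
                  λ { (s≤s ()) }
  where
  X⊆⁅x⁆ : ¬ (∃ λ y → y ∈ X × y ≢ x) → X ⊆ ⁅ x ⁆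
  X⊆⁅x⁆ none {y} y∈X =
    subst (_∈ ⁅ x ⁆) (sym (decidable-stable (y ≟ x) λ y≢x → none (y , y∈X , y≢x))) (x∈⁅x⁆ x)

subset : ∀ {n} {P : Pred (Fin n) 0ℓ} → Decidable P → Subset n
subset P? = tabulate (λ x → does (P? x))

module _ {n} {P : Pred (Fin n) 0ℓ} (P? : Decidable P) where

  ∈-subset⁺ : ∀ {x} → P x → x ∈ subset P?
  ∈-subset⁺ {x} px = lookup⇒[]= x _ (trans (lookup∘tabulate _ x) (dec-true (P? x) px))

  ∈-subset⁻ : ∀ {x} → x ∈ subset P? → P x
  ∈-subset⁻ {x} x∈ with P? x | trans (sym (lookup∘tabulate _ x)) ([]=⇒lookup x∈)
  ... | yes px | _  = px
  ... | no _   | ()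

module _ {A : Set} {R : A → A → Set} where

  Linked-++∷⁻ : ∀ xs {y ys} → Linked R (xs ++ y ∷ ys) → Linked R (xs ++ y ∷ []) × Linked R (y ∷ ys)
  Linked-++∷⁻ []            l       = [-] , l
  Linked-++∷⁻ (x ∷ [])      (r ∷ l) = r ∷ [-] , l
  Linked-++∷⁻ (x ∷ x′ ∷ xs) (r ∷ l) = map₁ (r ∷_) (Linked-++∷⁻ (x′ ∷ xs) l)

  Linked-++∷⁺ : ∀ xs {y ys} → Linked R (xs ++ y ∷ []) → Linked R (y ∷ ys) → Linked R (xs ++ y ∷ ys)
  Linked-++∷⁺ []            _        l = l
  Linked-++∷⁺ (x ∷ [])      (r ∷ _)  l = r ∷ l
  Linked-++∷⁺ (x ∷ x′ ∷ xs) (r ∷ l′) l = r ∷ Linked-++∷⁺ (x′ ∷ xs) l′ l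

  Linked-last : ∀ x xs {y} → Linked R (x ∷ xs ++ y ∷ []) → ∃ λ z → z ∈ₗ x ∷ xs × R z y
  Linked-last x []        (r ∷ _) = x , here refl , r
  Linked-last x (x′ ∷ xs) (_ ∷ l) = map₂ (map₁ there) (Linked-last x′ xs l)

  Linked-propagate : {K Y : Pred A 0ℓ} → (∀ {x y} → K x → Y y → R x y → K y) →
                     ∀ {x xs} → Linked R (x ∷ xs) → K x → All Y xs → All K xs
  Linked-propagate propagates [-]     _  []        = []
  Linked-propagate propagates (r ∷ l) kx (yy ∷ ys) = ky ∷ Linked-propagate propagates l ky ys
    where ky = propagates kx yy r

module _ {A : Set} where

  Unique-lookup-injective : ∀ {xs : List A} → Unique xs → ∀ {i j} → lookup xs i ≡ lookup xs j → i ≡ j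
  Unique-lookup-injective (_ ∷ _)  {zero}  {zero}  _  = refl
  Unique-lookup-injective (x∉ ∷ _) {zero}  {suc j} eq = contradiction eq (All.lookup x∉ (∈-lookup j))
  Unique-lookup-injective (x∉ ∷ _) {suc i} {zero}  eq =
    contradiction (sym eq) (All.lookup x∉ (∈-lookup i))
  Unique-lookup-injective (_ ∷ u)  {suc i} {suc j} eq = cong suc (Unique-lookup-injective u eq)

Unique⇒length≤ : ∀ {n} {xs : List (Fin n)} → Unique xs → length xs ≤ n
Unique⇒length≤ {xs = xs} u = injective⇒≤ {f = lookup xs} (Unique-lookup-injective u)

search≤ : ∀ {n} k {Q : Pred (List (Fin n)) 0ℓ} → Decidable Q → Dec (∃ λ xs → length xs ≤ k × Q xs)
search≤ zero    Q? = map′ (λ q → [] , z≤n , q) (λ { ([] , _ , q) → q ; (_ ∷ _ , () , _) }) (Q? [])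
search≤ (suc k) {Q} Q? = map′ join split (Q? [] ⊎-dec any? λ x → search≤ k (Q? ∘ (x ∷_)))
  where
  Split : Set
  Split = Q [] ⊎ ∃ λ x → ∃ λ xs → length xs ≤ k × Q (x ∷ xs)
  join : Split → ∃ λ xs → length xs ≤ suc k × Q xs
  join (inj₁ q)                 = [] , z≤n , q
  join (inj₂ (x , xs , ≤k , q)) = x ∷ xs , s≤s ≤k , q
  split : (∃ λ xs → length xs ≤ suc k × Q xs) → Split
  split ([] , _ , q)          = inj₁ q
  split (x ∷ xs , s≤s ≤k , q) = inj₂ (x , xs , ≤k , q)

module CycleConvexity {n : ℕ} (G : Graph n) where

  open UniqueDec (_≟_ {n}) using (unique?)
  open MembershipDec (_≟_ {n}) using () renaming (_∈?_ to _∈ₗ?_)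

  edge? : ∀ x y → Dec (Edge G x y)
  edge? x y = Graph.adj G x y Bool.≟ true

  Edge-sym : ∀ {x y} → Edge G x y → Edge G y x
  Edge-sym {x} {y} = trans (Graph.sym G y x)

  module _ {P : Pred (Fin n) 0ℓ} where

    walk-snoc : ∀ {x y z} → WalkIn G P x y → Edge G y z → P z → WalkIn G P x z
    walk-snoc here          yz pz = step yz pz here
    walk-snoc (step e py w) yz pz = step e py (walk-snoc w yz pz)

    walk-++ : ∀ {x y z} → WalkIn G P x y → WalkIn G P y z → WalkIn G P x z
    walk-++ here          w′ = w′
    walk-++ (step e py w) w′ = step e py (walk-++ w w′)

    walk-reverse : ∀ {x y} → P x → WalkIn G P x y → WalkIn G P y x
    walk-reverse px here          = here
    walk-reverse px (step e py w) = walk-snoc (walk-reverse py w) (Edge-sym e) px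

    walk-target : ∀ {x y} → P x → WalkIn G P x y → P y
    walk-target px here          = px
    walk-target _  (step _ py w) = walk-target py w

    connected-from : ∀ {r} → P r → (∀ {x} → P x → WalkIn G P r x) → ConnectedIn G P
    connected-from pr reach x y px py = walk-++ (walk-reverse pr (reach px)) (reach py)

  rotate : (c : Cycle G) {v : Fin n} → v ∈ₗ vertices G c →
           Σ (Cycle G) λ c′ → Cycle.start c′ ≡ v × vertices G c′ ↭ vertices G c
  rotate c (here refl) = c , refl , ↭-refl
  rotate (mkCycle s r long distinct closed) {v} (there v∈r) with ∈-∃++ v∈r
  ... | A , B , refl = mkCycle v (B ++ s ∷ A) long′ distinct′ closed′ , refl , rotation
    where
    rotation : v ∷ B ++ s ∷ A ↭ s ∷ A ++ v ∷ B
    rotation = ++-comm (v ∷ B) (s ∷ A)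
    long′ : 2 ≤ length (B ++ s ∷ A)
    long′ = subst (2 ≤_) (suc-injective (↭-length (↭-sym rotation))) long
    distinct′ : Unique (v ∷ B ++ s ∷ A)
    distinct′ = Permutationₛ.Unique-resp-↭ (setoid (Fin n)) (↭⇒↭ₛ (↭-sym rotation)) distinct
    closed′ : Linked (Edge G) (v ∷ (B ++ s ∷ A) ++ v ∷ [])
    closed′ with Linked-++∷⁻ (s ∷ A)
                   (subst (Linked (Edge G) ∘ (s ∷_)) (++-assoc A (v ∷ B) (s ∷ [])) closed)
    ... | s⋯v , v⋯s = subst (Linked (Edge G) ∘ (v ∷_)) (sym (++-assoc B (s ∷ A) (v ∷ [])))
                        (Linked-++∷⁺ (v ∷ B) v⋯s s⋯v)

  cycle-neighbours : (c : Cycle G) {v : Fin n} → v ∈ₗ vertices G c →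
                     ∃₂ λ x y → x ≢ y × x ∈ₗ vertices G c × y ∈ₗ vertices G c × Edge G v x × Edge G v y
  cycle-neighbours c v∈c with rotate c v∈c
  ... | mkCycle _ [] () _ _ , _ , _
  ... | mkCycle _ (_ ∷ []) (s≤s ()) _ _ , _ , _
  ... | mkCycle _ (x ∷ x′ ∷ r) _ (_ ∷ x∉ ∷ _) (vx ∷ _ ∷ closed) , refl , c′↭c
      with Linked-last x′ r closed
  ...   | y , y∈ , yv =
          x , y , All.lookup x∉ y∈
            , ∈-resp-↭ c′↭c (there (here refl)) , ∈-resp-↭ c′↭c (there (there y∈)) , vx , Edge-sym yv

  cycle-neighbour-avoiding : (c : Cycle G) {x : Fin n} → x ∈ₗ vertices G c → ∀ u →
                             ∃ λ y → y ∈ₗ vertices G c × y ≢ u × Edge G x y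
  cycle-neighbour-avoiding c x∈c u with cycle-neighbours c x∈c
  ... | y₁ , y₂ , y₁≢y₂ , y₁∈c , y₂∈c , xy₁ , xy₂ with y₁ ≟ u
  ...   | yes refl = y₂ , y₂∈c , y₁≢y₂ ∘ sym , xy₂
  ...   | no y₁≢u  = y₁ , y₁∈c , y₁≢u , xy₁

  cycle-on? : ∀ xs → Dec (Σ (Cycle G) λ c → vertices G c ≡ xs)
  cycle-on? []       = no λ { (_ , ()) }
  cycle-on? (s ∷ r) =
    map′ (λ (long , distinct , closed) → mkCycle s r long distinct closed , refl)
         (λ { (mkCycle _ _ long distinct closed , refl) → long , distinct , closed })
         ((2 ≤? length r) ×-dec unique? (s ∷ r) ×-dec linked? edge? (s ∷ r ++ s ∷ []))

  cycle? : {Q : Pred (List (Fin n)) 0ℓ} → Decidable Q → Dec (Σ (Cycle G) λ c → Q (vertices G c))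
  cycle? Q? =
    map′ (λ { (_ , _ , (c , refl) , q) → c , q })
         (λ (c , q) → vertices G c , Unique⇒length≤ (Cycle.distinct c) , (c , refl) , q)
         (search≤ n λ xs → cycle-on? xs ×-dec Q? xs)

  hasCycleThrough? : ∀ X u → Dec (HasCycleThrough G X u)
  hasCycleThrough? X u = cycle? λ xs → All.all? (_∈? X) xs ×-dec u ∈ₗ? xs

  cycleConvex? : ∀ T → Dec (CycleConvex G T)
  cycleConvex? T = all? λ u → ¬? (u ∈? T) →-dec ¬? (hasCycleThrough? (T ∪ ⁅ u ⁆) u)

  ∈⟨⟩? : ∀ x X → Dec (_∈⟨_⟩ G x X)
  ∈⟨⟩? x X = map′ none⇒∈⟨⟩ ∈⟨⟩⇒none (¬? (anySubset? counterexample?))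
    where
    Counterexample : Subset n → Set
    Counterexample T = CycleConvex G T × X ⊆ T × x ∉ T
    counterexample? : Decidable Counterexample
    counterexample? T = cycleConvex? T ×-dec X ⊆? T ×-dec ¬? (x ∈? T)
    none⇒∈⟨⟩ : ¬ ∃ Counterexample → _∈⟨_⟩ G x X
    none⇒∈⟨⟩ none T cv X⊆T = decidable-stable (x ∈? T) λ x∉T → none (T , cv , X⊆T , x∉T)
    ∈⟨⟩⇒none : _∈⟨_⟩ G x X → ¬ ∃ Counterexample
    ∈⟨⟩⇒none x∈⟨X⟩ (T , cv , X⊆T , x∉T) = x∉T (x∈⟨X⟩ T cv X⊆T)

  module Reachability {P : Pred (Fin n) 0ℓ} (P? : Decidable P) (r : Fin n) where

    Within : ℕ → Pred (Fin n) 0ℓ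
    Within zero    z = z ≡ r
    Within (suc k) z = Within k z ⊎ (P z × ∃ λ w → Within k w × Edge G w z)

    within? : ∀ k → Decidable (Within k)
    within? zero    z = z ≟ r
    within? (suc k) z = within? k z ⊎-dec (P? z ×-dec any? λ w → within? k w ×-dec edge? w z)

    within⇒walk : ∀ k {z} → Within k z → WalkIn G P r z
    within⇒walk zero    refl                      = here
    within⇒walk (suc k) (inj₁ z∈)                 = within⇒walk k z∈
    within⇒walk (suc k) (inj₂ (pz , _ , w∈ , wz)) = walk-snoc (within⇒walk k w∈) wz pz

    within-root : ∀ k → Within k r
    within-root zero    = refl
    within-root (suc k) = inj₁ (within-root k)

    Saturated : ℕ → Set
    Saturated k = ∀ {z} → Within (suc k) z → Within k z

    saturated-walk : ∀ {k x z} → Saturated k → WalkIn G P x z → Within k x → Within k z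
    saturated-walk sat here          x∈ = x∈
    saturated-walk sat (step e py w) x∈ = saturated-walk sat w (sat (inj₂ (py , _ , x∈ , e)))

    layer : ℕ → Subset n
    layer k = subset (within? k)

    -- Until saturation every layer gains a vertex, and a subset of Fin n has at most n elements.
    growth : ∀ k → ∃ Saturated ⊎ k ≤ ∣ layer k ∣
    growth zero = inj₂ z≤n
    growth (suc k) with growth k | any? (λ z → within? (suc k) z ×-dec ¬? (within? k z))
    ... | inj₁ sat | _                   = inj₁ sat
    ... | inj₂ k≤  | yes (z , new , old) = inj₂ (≤-trans (s≤s k≤) (p⊂q⇒∣p∣<∣q∣ layer⊂))
      where
      layer⊂ : layer k ⊂ layer (suc k)
      layer⊂ = ∈-subset⁺ (within? (suc k)) ∘ inj₁ ∘ ∈-subset⁻ (within? k)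
             , z , ∈-subset⁺ (within? (suc k)) new , old ∘ ∈-subset⁻ (within? k)
    ... | inj₂ _   | no none             =
          inj₁ (k , λ {z} z∈ → decidable-stable (within? k z) λ z∉ → none (z , z∈ , z∉))

    saturation : ∃ Saturated
    saturation with growth (suc n)
    ... | inj₁ sat = sat
    ... | inj₂ n<  = contradiction (≤-trans n< (∣p∣≤n (layer (suc n)))) (<-irrefl refl)

    reachable? : Decidable (WalkIn G P r)
    reachable? z with saturation
    ... | k , sat = map′ (within⇒walk k) (λ w → saturated-walk sat w (within-root k)) (within? k z)

  ∈∪⁅⁆⁻ : ∀ {X : Subset n} {u z} → z ∈ X ∪ ⁅ u ⁆ → z ∈ X ⊎ z ≡ u
  ∈∪⁅⁆⁻ {X} {u} z∈ = Sum.map₂ (x∈⁅y⁆⇒x≡y u) (x∈p∪q⁻ X ⁅ u ⁆ z∈)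

  cycleIn-intro : ∀ {Y} (c : Cycle G) {u} → u ∈ₗ vertices G c → u ∈ Y →
                  (∀ {z} → z ∈ₗ vertices G c → z ≢ u → z ∈ Y) → CycleIn G Y c
  cycleIn-intro {Y} c {u} _ u∈Y others = All.tabulate in-Y
    where
    in-Y : ∀ {z} → z ∈ₗ vertices G c → z ∈ Y
    in-Y {z} z∈c with z ≟ u
    ... | yes refl = u∈Y
    ... | no z≢u   = others z∈c z≢u

  CycleClosed : Subset n → Set
  CycleClosed T = ∀ (c : Cycle G) {u} → u ∈ₗ vertices G c →
                  (∀ {z} → z ∈ₗ vertices G c → z ≢ u → z ∈ T) → u ∈ T

  convex⇒closed : ∀ {T} → CycleConvex G T → CycleClosed T
  convex⇒closed {T} cv c {u} u∈c others = decidable-stable (u ∈? T) λ u∉T → cv u u∉T (c , c⊆T∪u , u∈c)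
    where
    c⊆T∪u : CycleIn G (T ∪ ⁅ u ⁆) c
    c⊆T∪u = cycleIn-intro c u∈c (x∈p∪q⁺ (inj₂ (x∈⁅x⁆ u))) (λ z∈c → x∈p∪q⁺ ∘ inj₁ ∘ others z∈c)

  closed⇒convex : ∀ {T} → CycleClosed T → CycleConvex G T
  closed⇒convex {T} closed u u∉T (c , c⊆T∪u , u∈c) = u∉T (closed c u∈c in-T)
    where
    in-T : ∀ {z} → z ∈ₗ vertices G c → z ≢ u → z ∈ T
    in-T z∈c z≢u = [ id , (λ z≡u → contradiction z≡u z≢u) ]′ (∈∪⁅⁆⁻ (All.lookup c⊆T∪u z∈c))

  ⊆⟨⟩ : ∀ {X x} → x ∈ X → _∈⟨_⟩ G x X
  ⊆⟨⟩ x∈X _ _ X⊆T = X⊆T x∈X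

  ⟨⟩-⊆ : ∀ {X X′} → (∀ {y} → y ∈ X → _∈⟨_⟩ G y X′) → ∀ {x} → _∈⟨_⟩ G x X → _∈⟨_⟩ G x X′
  ⟨⟩-⊆ X⊆⟨X′⟩ x∈⟨X⟩ T cv X′⊆T = x∈⟨X⟩ T cv λ y∈X → X⊆⟨X′⟩ y∈X T cv X′⊆T

  ⟨⟩-mono : ∀ {X X′} → X ⊆ X′ → ∀ {x} → _∈⟨_⟩ G x X → _∈⟨_⟩ G x X′
  ⟨⟩-mono X⊆X′ = ⟨⟩-⊆ (⊆⟨⟩ ∘ X⊆X′)

  ⟨⟩-closed : ∀ {X} (c : Cycle G) {u} → u ∈ₗ vertices G c →
              (∀ {z} → z ∈ₗ vertices G c → z ≢ u → _∈⟨_⟩ G z X) → _∈⟨_⟩ G u X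
  ⟨⟩-closed c u∈c others T cv X⊆T = convex⇒closed cv c u∈c λ z∈c z≢u → others z∈c z≢u T cv X⊆T

  hull : Subset n → Subset n
  hull X = subset λ x → ∈⟨⟩? x X

  ∈-hull⁺ : ∀ {X x} → _∈⟨_⟩ G x X → x ∈ hull X
  ∈-hull⁺ {X} = ∈-subset⁺ λ x → ∈⟨⟩? x X

  ∈-hull⁻ : ∀ {X x} → x ∈ hull X → _∈⟨_⟩ G x X
  ∈-hull⁻ {X} = ∈-subset⁻ λ x → ∈⟨⟩? x X

  hull-convex : ∀ X → CycleConvex G (hull X)
  hull-convex X = closed⇒convex λ c u∈c others →
    ∈-hull⁺ (⟨⟩-closed c u∈c λ z∈c z≢u → ∈-hull⁻ (others z∈c z≢u))

  edgeless-convex : ∀ {X} → (∀ {x y} → x ∈ X → y ∈ X → ¬ Edge G x y) → CycleConvex G X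
  edgeless-convex edgeless = closed⇒convex λ c {u} u∈c others →
    let (x , x∈c , x≢u , _)  = cycle-neighbour-avoiding c u∈c u
        (y , y∈c , y≢u , xy) = cycle-neighbour-avoiding c x∈c u
    in ⊥-elim (edgeless (others x∈c x≢u) (others y∈c y≢u) xy)

  convex-minus : ∀ {Y v} → CycleConvex G Y → ¬ HasCycleThrough G Y v → CycleConvex G (Y - v)
  convex-minus {Y} {v} cvY acyclic = closed⇒convex closed
    where
    closed : CycleClosed (Y - v)
    closed c {u} u∈c others = x∈p∧x≢y⇒x∈p-y u∈Y λ u≡v →
      acyclic (c , cycleIn-intro c u∈c u∈Y in-Y , subst (_∈ₗ vertices G c) u≡v u∈c)
      where
      in-Y : ∀ {z} → z ∈ₗ vertices G c → z ≢ u → z ∈ Y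
      in-Y z∈c z≢u = p─q⊆p Y ⁅ v ⁆ (others z∈c z≢u)
      u∈Y : u ∈ Y
      u∈Y = convex⇒closed cvY c u∈c in-Y

  convex-∪-acyclic : ∀ {X Y v} → CycleConvex G X → CycleConvex G Y → X ⊆ Y → v ∈ Y →
                     ¬ HasCycleThrough G Y v → CycleConvex G (X ∪ ⁅ v ⁆)
  convex-∪-acyclic {X} {Y} {v} cvX cvY X⊆Y v∈Y acyclic = closed⇒convex closed
    where
    closed : CycleClosed (X ∪ ⁅ v ⁆)
    closed c {u} u∈c others with v ∈ₗ? vertices G c
    ... | yes v∈c = ⊥-elim (acyclic (c , cycleIn-intro c u∈c u∈Y in-Y , v∈c))
      where
      in-Y : ∀ {z} → z ∈ₗ vertices G c → z ≢ u → z ∈ Y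
      in-Y z∈c z≢u = [ X⊆Y , (λ z≡v → subst (_∈ Y) (sym z≡v) v∈Y) ]′ (∈∪⁅⁆⁻ (others z∈c z≢u))
      u∈Y : u ∈ Y
      u∈Y = convex⇒closed cvY c u∈c in-Y
    ... | no v∉c = x∈p∪q⁺ (inj₁ (convex⇒closed cvX c u∈c in-X))
      where
      in-X : ∀ {z} → z ∈ₗ vertices G c → z ≢ u → z ∈ X
      in-X z∈c z≢u = [ id , (λ z≡v → contradiction (subst (_∈ₗ vertices G c) z≡v z∈c) v∉c) ]′
                       (∈∪⁅⁆⁻ (others z∈c z≢u))

  NeighbourClosed : Subset n → Subset n → Set
  NeighbourClosed Y K = ∀ {x y} → x ∈ K → y ∈ Y → Edge G x y → y ∈ K

  neighbourClosed-cycle : ∀ {Y K} → NeighbourClosed Y K → (c : Cycle G) → CycleIn G Y c →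
                          ∀ {v} → v ∈ₗ vertices G c → v ∈ K → CycleIn G K c
  neighbourClosed-cycle closed c c⊆Y v∈c v∈K with rotate c v∈c
  ... | mkCycle _ r _ _ links , refl , c′↭c with All-resp-↭ (↭-sym c′↭c) c⊆Y
  ...   | v∈Y ∷ r⊆Y =
          All-resp-↭ c′↭c (v∈K ∷ Allₚ.++⁻ˡ r (Linked-propagate closed links v∈K (Allₚ.++⁺ r⊆Y (v∈Y ∷ []))))

  neighbourClosed-convex : ∀ {Y K} → CycleConvex G Y → K ⊆ Y → NeighbourClosed Y K → CycleConvex G K
  neighbourClosed-convex cvY K⊆Y closed = closed⇒convex λ c {u} u∈c others →
    let (x , x∈c , x≢u , ux) = cycle-neighbour-avoiding c u∈c u
    in closed (others x∈c x≢u) (convex⇒closed cvY c u∈c (λ z∈c → K⊆Y ∘ others z∈c)) (Edge-sym ux)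

  separated-convex : ∀ {Y K Z} → CycleConvex G Y → K ⊆ Y → NeighbourClosed Y K →
                     CycleConvex G Z → CycleConvex G ((Z ∩ K) ∪ (Y ─ K))
  separated-convex {Y} {K} {Z} cvY K⊆Y closed cvZ = closed⇒convex cycle-closed
    where
    T⊆Y : (Z ∩ K) ∪ (Y ─ K) ⊆ Y
    T⊆Y z∈T = [ K⊆Y ∘ proj₂ ∘ x∈p∩q⁻ Z K , p─q⊆p Y K ]′ (x∈p∪q⁻ _ _ z∈T)
    cycle-closed : CycleClosed ((Z ∩ K) ∪ (Y ─ K))
    cycle-closed c {u} u∈c others = place (u ∈? K)
      where
      u∈Y : u ∈ Y
      u∈Y = convex⇒closed cvY c u∈c (λ z∈c → T⊆Y ∘ others z∈c)
      place : Dec (u ∈ K) → u ∈ (Z ∩ K) ∪ (Y ─ K)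
      place (no u∉K)  = x∈p∪q⁺ (inj₂ (x∈p∧x∉q⇒x∈p─q u∈Y u∉K))
      place (yes u∈K) = x∈p∪q⁺ (inj₁ (x∈p∩q⁺ (convex⇒closed cvZ c u∈c in-Z , u∈K)))
        where
        c⊆K : CycleIn G K c
        c⊆K = neighbourClosed-cycle closed c (cycleIn-intro c u∈c u∈Y λ z∈c → T⊆Y ∘ others z∈c) u∈c u∈K
        in-Z : ∀ {z} → z ∈ₗ vertices G c → z ≢ u → z ∈ Z
        in-Z z∈c z≢u =
          [ proj₁ ∘ x∈p∩q⁻ Z K , contradiction (All.lookup c⊆K z∈c) ∘ x∈p─q⇒x∉q Y K ]′
            (x∈p∪q⁻ _ _ (others z∈c z≢u))

module CIndependence {n} {G : Graph n} {S : Subset n} (ci : CIndependent G S) (two : 2 ≤ ∣ S ∣) where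

  open CycleConvexity G

  p : Fin n
  p = proj₁ ci

  p∈⟨S⟩ : _∈⟨_⟩ G p S
  p∈⟨S⟩ = proj₁ (proj₂ ci)

  p∉⟨S-a⟩ : ∀ {a} → a ∈ S → ¬ _∈⟨_⟩ G p (S - a)
  p∉⟨S-a⟩ = proj₂ (proj₂ ci) _

  p∉S : p ∉ S
  p∉S p∈S with another-element two p
  ... | b , b∈S , b≢p = p∉⟨S-a⟩ b∈S (⊆⟨⟩ (x∈p∧x≢y⇒x∈p-y p∈S (b≢p ∘ sym)))

  not-convex : ¬ CycleConvex G S
  not-convex cv = p∉S (p∈⟨S⟩ S cv (λ x∈S → x∈S))

  edge-in-S : ∃ λ x → ∃ λ y → x ∈ S × y ∈ S × Edge G x y
  edge-in-S =
    decidable-stable (any? λ x → any? λ y → x ∈? S ×-dec y ∈? S ×-dec edge? x y) λ no-edge →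
      not-convex (edgeless-convex λ x∈S y∈S xy → no-edge (_ , _ , x∈S , y∈S , xy))

  no-spanning-proper-subset : ∀ S′ → S′ ⊂ S → ¬ (∀ x → _∈⟨_⟩ G x S′)
  no-spanning-proper-subset S′ (S′⊆S , a , a∈S , a∉S′) spanning =
    p∉⟨S-a⟩ a∈S (⟨⟩-mono S′⊆S-a (spanning p))
    where
    S′⊆S-a : S′ ⊆ S - a
    S′⊆S-a x∈S′ = x∈p∧x≢y⇒x∈p-y (S′⊆S x∈S′) λ x≡a → a∉S′ (subst (_∈ S′) x≡a x∈S′)

  forest : Forest G S
  forest c c⊆S = p∉⟨S-a⟩ a∈S (⟨⟩-⊆ S⊆⟨S-a⟩ p∈⟨S⟩)
    where
    a = Cycle.start c
    a∈S = All.lookup c⊆S (here refl)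
    S⊆⟨S-a⟩ : ∀ {x} → x ∈ S → _∈⟨_⟩ G x (S - a)
    S⊆⟨S-a⟩ {x} x∈S with x ≟ a
    ... | yes refl =
          ⟨⟩-closed c (here refl) λ z∈c z≢a → ⊆⟨⟩ (x∈p∧x≢y⇒x∈p-y (All.lookup c⊆S z∈c) z≢a)
    ... | no x≢a   = ⊆⟨⟩ (x∈p∧x≢y⇒x∈p-y x∈S x≢a)

  ⟨S-a⟩∪a-not-convex : ∀ {a} → a ∈ S → ¬ CycleConvex G (hull (S - a) ∪ ⁅ a ⁆)
  ⟨S-a⟩∪a-not-convex {a} a∈S cv =
    [ p∉⟨S-a⟩ a∈S ∘ ∈-hull⁻ , (λ p≡a → p∉S (subst (_∈ S) (sym p≡a) a∈S)) ]′
      (∈∪⁅⁆⁻ (p∈⟨S⟩ _ cv S⊆))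
    where
    S⊆ : S ⊆ hull (S - a) ∪ ⁅ a ⁆
    S⊆ {x} x∈S with x ≟ a
    ... | yes refl = x∈p∪q⁺ (inj₂ (x∈⁅x⁆ x))
    ... | no x≢a   = x∈p∪q⁺ (inj₁ (∈-hull⁺ (⊆⟨⟩ (x∈p∧x≢y⇒x∈p-y x∈S x≢a))))

  on-cycle-in-hull : ∀ {v} → _∈⟨_⟩ G v S → HasCycleThrough G (hull S) v
  on-cycle-in-hull {v} v∈⟨S⟩ =
    decidable-stable (hasCycleThrough? (hull S) v) λ acyclic → removable acyclic (v ∈? S)
    where
    removable : ¬ HasCycleThrough G (hull S) v → Dec (v ∈ S) → ⊥
    removable acyclic (yes v∈S) =
      ⟨S-a⟩∪a-not-convex v∈S
        (convex-∪-acyclic (hull-convex (S - v)) (hull-convex S)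
                          (∈-hull⁺ ∘ ⟨⟩-mono (p─q⊆p S ⁅ v ⁆) ∘ ∈-hull⁻) (∈-hull⁺ v∈⟨S⟩) acyclic)
    removable acyclic (no v∉S) =
      x∈p─q⇒x∉q (hull S) ⁅ v ⁆ (v∈⟨S⟩ _ (convex-minus (hull-convex S) acyclic) S⊆) (x∈⁅x⁆ v)
      where
      S⊆ : S ⊆ hull S - v
      S⊆ {x} x∈S = x∈p∧x≢y⇒x∈p-y (∈-hull⁺ (⊆⟨⟩ x∈S)) λ x≡v → v∉S (subst (_∈ S) x≡v x∈S)

  vertex-on-cycle : ∀ a → a ∈ S → Σ (Cycle G) λ c → a ∈ₗ vertices G c
  vertex-on-cycle a a∈S with on-cycle-in-hull (⊆⟨⟩ a∈S)
  ... | c , _ , a∈c = c , a∈c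

  no-leaf : ∀ v → _∈⟨_⟩ G v S → ¬ DegreeOneIn G (λ x → _∈⟨_⟩ G x S) v
  no-leaf v v∈⟨S⟩ (w , _ , _ , only-w) with on-cycle-in-hull v∈⟨S⟩
  ... | c , c⊆⟨S⟩ , v∈c with cycle-neighbours c v∈c
  ...   | x , y , x≢y , x∈c , y∈c , vx , vy =
          x≢y (trans (only-w x (in-⟨S⟩ x∈c) vx) (sym (only-w y (in-⟨S⟩ y∈c) vy)))
    where
    in-⟨S⟩ : ∀ {z} → z ∈ₗ vertices G c → _∈⟨_⟩ G z S
    in-⟨S⟩ = ∈-hull⁻ ∘ All.lookup c⊆⟨S⟩

  ∈⟨S⟩? : Decidable λ x → _∈⟨_⟩ G x S
  ∈⟨S⟩? x = ∈⟨⟩? x S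

  open Reachability ∈⟨S⟩? p using (reachable?)

  component : Subset n
  component = subset reachable?

  component⊆hull : component ⊆ hull S
  component⊆hull x∈K = ∈-hull⁺ (walk-target p∈⟨S⟩ (∈-subset⁻ reachable? x∈K))

  component-closed : NeighbourClosed (hull S) component
  component-closed x∈K y∈⟨S⟩ xy =
    ∈-subset⁺ reachable? (walk-snoc (∈-subset⁻ reachable? x∈K) xy (∈-hull⁻ y∈⟨S⟩))

  S⊆component : S ⊆ component
  S⊆component {a} a∈S =
    decidable-stable (a ∈? K) λ a∉K → p∉⟨S-a⟩ a∈S (⟨⟩-mono (S∩K⊆S-a a∉K) p∈⟨S∩K⟩)
    where
    K = component
    T = (hull (S ∩ K) ∩ K) ∪ (hull S ─ K)
    S⊆T : S ⊆ T
    S⊆T {x} x∈S with x ∈? K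
    ... | yes x∈K = x∈p∪q⁺ (inj₁ (x∈p∩q⁺ (∈-hull⁺ (⊆⟨⟩ (x∈p∩q⁺ (x∈S , x∈K))) , x∈K)))
    ... | no x∉K  = x∈p∪q⁺ (inj₂ (x∈p∧x∉q⇒x∈p─q (∈-hull⁺ (⊆⟨⟩ x∈S)) x∉K))
    p∈T : p ∈ T
    p∈T = p∈⟨S⟩ T T-convex S⊆T
      where T-convex = separated-convex (hull-convex S) component⊆hull component-closed (hull-convex (S ∩ K))
    p∈⟨S∩K⟩ : _∈⟨_⟩ G p (S ∩ K)
    p∈⟨S∩K⟩ =
      [ ∈-hull⁻ ∘ proj₁ ∘ x∈p∩q⁻ _ K , contradiction (∈-subset⁺ reachable? here) ∘ x∈p─q⇒x∉q _ K ]′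
        (x∈p∪q⁻ _ _ p∈T)
    S∩K⊆S-a : a ∉ K → S ∩ K ⊆ S - a
    S∩K⊆S-a a∉K x∈S∩K with x∈p∩q⁻ S K x∈S∩K
    ... | x∈S , x∈K = x∈p∧x≢y⇒x∈p-y x∈S λ x≡a → a∉K (subst (_∈ K) x≡a x∈K)

  hull-connected : ConnectedIn G (λ x → _∈⟨_⟩ G x S)
  hull-connected = connected-from p∈⟨S⟩ λ x∈⟨S⟩ →
    ∈-subset⁻ reachable? (x∈⟨S⟩ component component-convex S⊆component)
    where
    component-convex : CycleConvex G component
    component-convex = neighbourClosed-convex (hull-convex S) component⊆hull component-closed

lemma2p1 : ∀ {n} (G : Graph n) (S : Subset n) → CIndependent G S → 2 ≤ ∣ S ∣ →
    (∃ λ x → ∃ λ y → x ∈ S × y ∈ S × Edge G x y)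
    × (∀ a → a ∈ S → Σ (Cycle G) λ c → a ∈ₗ vertices G c)
    × ConnectedIn G (λ x → _∈⟨_⟩ G x S)
    × (∀ S′ → S′ ⊂ S → ¬ (∀ x → _∈⟨_⟩ G x S′))
    × Forest G S
    × (∀ v → _∈⟨_⟩ G v S → ¬ DegreeOneIn G (λ x → _∈⟨_⟩ G x S) v)
    × ¬ CycleConvex G S
lemma2p1 G S ci two =
  edge-in-S , vertex-on-cycle , hull-connected , no-spanning-proper-subset , forest , no-leaf , not-convex
  where open CIndependence ci two
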